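{- Let $G\in\mathbb{Np}^\infty$ be any form and let $H\in\mathbb{Np}^\infty$ be invertible with inverse $-H$. Then $G\succcurlyeq H$ if and only if $o(G+(-H))\in\{\mathscr L,\mathscr P\}$, and $G=H$ if and only if $o(G+(-H))=\mathscr P$.
   Context: Affine normal play forms $\mathbb{Np}^\infty$ are defined recursively: two atomic forms $\infty$ and $\overline{\infty}$ with no options; every other form is $G=\{G^{\mathcal L}\mid G^{\mathcal R}\}$ with finite nonempty sets of previously constructed forms as Left and Right options. Disjunctive sum: $\infty+X=X+\infty=\infty$ for $X\neq\overline{\infty}$; $\overline{\infty}+X=X+\overline{\infty}=\overline{\infty}$ for $X\ne\infty$; $\infty+\overline{\infty}$ undefined; otherwise $G+H=\{G^L+H,G+H^L\mid G^R+H,G+H^R\}$. Outcomes: Left wins $\infty$ and Right wins $\overline{\infty}$ whoever moves; otherwise play alternates, Left moving first wins iff some Left option is won by Left moving second, Left moving second wins iff every Right option is won by Left moving first, symmetrically for Right. $o(G)\in\{\mathscr L,\mathscr N,\mathscr P,\mathscr R\}$ (Left wins either way, first player wins, second player wins, Right wins either way), ordered $\mathscr L>\mathscr N,\mathscr P>\mathscr R$ with $\mathscr N,\mathscr P$ incomparable. $G\succcurlyeq H$ means $o(G+X)\geqslant o(H+X)$ for all $X\in\mathbb{Np}^\infty\setminus\{\infty,\overline\infty\}$; $G=H$ means both directions. $0=\{\overline\infty\mid\infty\}$. $H$ is invertible if there is $K\in\mathbb{Np}^\infty$ with $H+K=0$; such $K$ is denoted $-H$. -}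

module Defs where

open import Data.Nat using (ℕ; zero; suc; _+_)
open import Data.Fin using (Fin; splitAt)
open import Data.Bool using (Bool; true; false; _∧_; _∨_; not)
open import Data.Sum using (_⊎_; inj₁; inj₂; [_,_])
open import Data.Product using (_×_; Σ)
open import Relation.Binary.PropositionalEquality using (_≡_)
open import Relation.Nullary using (¬_)

-- Affine normal play forms.  A non-atomic form {G^L | G^R} has finitely
-- many (and at least one) Left options, indexed by Fin (suc m), and
-- at least one Right option, indexed by Fin (suc n).
data Form : Set where
  ∞    : Form
  ∞̄    : Form
  node : (m : ℕ) → (Fin (suc m) → Form) → (n : ℕ) → (Fin (suc n) → Form) → Form

data NonAtomic : Form → Set where
  node : ∀ m L n R → NonAtomic (node m L n R)

Defined : Form → Form → Set
Defined G H = ¬ (G ≡ ∞ × H ≡ ∞̄) × ¬ (G ≡ ∞̄ × H ≡ ∞)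

-- Disjunctive sum.  The undefined case ∞ + ∞̄ (and ∞̄ + ∞) is given the
-- junk value ∞; the statement only uses sums that are Defined.
infixl 6 _⊕_
_⊕_ : Form → Form → Form
∞ ⊕ H = ∞
∞̄ ⊕ ∞ = ∞
∞̄ ⊕ H = ∞̄
node m L n R ⊕ ∞ = ∞
node m L n R ⊕ ∞̄ = ∞̄
node m L n R ⊕ node m' L' n' R' =
  node (m + suc m')
       (λ i → [ (λ j → L j ⊕ node m' L' n' R') , (λ j → node m L n R ⊕ L' j) ] (splitAt (suc m) i))
       (n + suc n')
       (λ i → [ (λ j → R j ⊕ node m' L' n' R') , (λ j → node m L n R ⊕ R' j) ] (splitAt (suc n) i))

anyFin : (k : ℕ) → (Fin k → Bool) → Bool
anyFin zero f = false
anyFin (suc k) f = f Fin.zero ∨ anyFin k (λ i → f (Fin.suc i))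

allFin : (k : ℕ) → (Fin k → Bool) → Bool
allFin zero f = true
allFin (suc k) f = f Fin.zero ∧ allFin k (λ i → f (Fin.suc i))

mutual
  leftFirst : Form → Bool
  leftFirst ∞ = true
  leftFirst ∞̄ = false
  leftFirst (node m L n R) = anyFin (suc m) (λ i → leftSecond (L i))

  leftSecond : Form → Bool
  leftSecond ∞ = true
  leftSecond ∞̄ = false
  leftSecond (node m L n R) = allFin (suc n) (λ j → leftFirst (R j))

mutual
  rightFirst : Form → Bool
  rightFirst ∞ = false
  rightFirst ∞̄ = true
  rightFirst (node m L n R) = anyFin (suc n) (λ j → rightSecond (R j))

  rightSecond : Form → Bool
  rightSecond ∞ = false
  rightSecond ∞̄ = true
  rightSecond (node m L n R) = allFin (suc m) (λ i → rightFirst (L i))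

data Outcome : Set where
  𝓛 𝓝 𝓟 𝓡 : Outcome

-- Outcome from who wins moving first (the game tree is finite, so the
-- player not winning moving first loses against the second player).
outcomeFrom : Bool → Bool → Outcome
outcomeFrom true  true  = 𝓝
outcomeFrom true  false = 𝓛
outcomeFrom false true  = 𝓡
outcomeFrom false false = 𝓟

o : Form → Outcome
o G = outcomeFrom (leftFirst G) (rightFirst G)

data _≥o_ : Outcome → Outcome → Set where
  refl≥ : ∀ {x} → x ≥o x
  top   : ∀ {x} → 𝓛 ≥o x
  bot   : ∀ {x} → x ≥o 𝓡

_≽_ : Form → Form → Set
G ≽ H = ∀ X → NonAtomic X → o (G ⊕ X) ≥o o (H ⊕ X)

_≈_ : Form → Form → Set
G ≈ H = G ≽ H × H ≽ G

zeroF : Form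
zeroF = node 0 (λ _ → ∞̄) 0 (λ _ → ∞)

IsInverse : Form → Form → Set
IsInverse H K = Defined H K × (H ⊕ K) ≈ zeroF

Invertible : Form → Set
Invertible H = Σ Form (IsInverse H)

-- Let N be the inverse of H. Both players win 0 = {∞̄ | ∞} moving second, so adding 0
-- changes no outcome, and since + is commutative and associative up to bisimilarity,
-- o((G + N) + (H + X)) = o((H + N) + (G + X)) = o(G + X) for every non-atomic G and X.
-- A summand that Left wins moving second can only help Left, so if Left wins G + N
-- moving second then o(G + X) ≥ o(H + X), i.e. G ≽ H; symmetrically, if Right wins
-- G + N moving second then H ≽ G. Conversely, X = N in the definition of ≽ compares
-- o(G + N) with o(H + N) = 𝓟.
module Submission where

open import Defs
open import Data.Bool using (Bool; true; false; not; T)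
open import Data.Bool.Properties using (T-∨; T-∧; not-involutive)
open import Data.Empty using (⊥-elim)
open import Data.Fin using (zero; suc; _↑ˡ_; _↑ʳ_)
open import Data.Nat using (ℕ; zero; suc; _+_)
open import Data.Product using (_×_; _,_; proj₁; proj₂)
open import Data.Sum using (_⊎_; inj₁; inj₂)
open import Data.Vec.Functional using (Vector; _++_; map)
open import Data.Vec.Functional.Properties using (lookup-++ˡ; lookup-++ʳ)
open import Data.Vec.Functional.Relation.Unary.All using (All)
open import Data.Vec.Functional.Relation.Unary.All.Properties using (++⁺)
open import Data.Vec.Functional.Relation.Unary.Any using (Any)
open import Function using (_∘_; flip)
open import Function.Bundles using (_⇔_; mk⇔; module Equivalence)
open import Level using (0ℓ)
open import Relation.Binary.Bundles using (Setoid)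
open import Relation.Binary.PropositionalEquality
  using (_≡_; refl; sym; trans; cong; subst; subst₂; module ≡-Reasoning)

open Equivalence using (to; from)

private
  variable
    a b c d : ℕ
    S : Set
    A B C A′ B′ : Form

Any-++⁺ˡ : (P : S → Set) {xs : Vector S a} (ys : Vector S b) → Any P xs → Any P (xs ++ ys)
Any-++⁺ˡ P {xs} ys (i , p) = i ↑ˡ _ , subst P (sym (lookup-++ˡ xs ys i)) p

Any-++⁺ʳ : (P : S → Set) (xs : Vector S a) {ys : Vector S b} → Any P ys → Any P (xs ++ ys)
Any-++⁺ʳ P xs {ys} (j , p) = _ ↑ʳ j , subst P (sym (lookup-++ʳ xs ys j)) p

T-anyFin : (p : S → Bool) (xs : Vector S a) → T (anyFin a (p ∘ xs)) ⇔ Any (T ∘ p) xs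
T-anyFin {a = zero} p xs = mk⇔ (λ ()) (λ ())
T-anyFin {a = suc a} p xs = mk⇔ to′ from′
  where
  to′ : T (anyFin (suc a) (p ∘ xs)) → Any (T ∘ p) xs
  to′ t with to T-∨ t
  ... | inj₁ q = zero , q
  ... | inj₂ q = let (i , r) = to (T-anyFin p (xs ∘ suc)) q in suc i , r
  from′ : Any (T ∘ p) xs → T (anyFin (suc a) (p ∘ xs))
  from′ (zero , q) = from T-∨ (inj₁ q)
  from′ (suc i , q) = from T-∨ (inj₂ (from (T-anyFin p (xs ∘ suc)) (i , q)))

T-allFin : (p : S → Bool) (xs : Vector S a) → T (allFin a (p ∘ xs)) ⇔ All (T ∘ p) xs
T-allFin {a = zero} p xs = mk⇔ (λ _ ()) (λ _ → _)
T-allFin {a = suc a} p xs = mk⇔ to′ from′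
  where
  to′ : T (allFin (suc a) (p ∘ xs)) → All (T ∘ p) xs
  to′ t zero = proj₁ (to T-∧ t)
  to′ t (suc i) = to (T-allFin p (xs ∘ suc)) (proj₂ (to T-∧ t)) i
  from′ : All (T ∘ p) xs → T (allFin (suc a) (p ∘ xs))
  from′ h = from T-∧ (h zero , from (T-allFin p (xs ∘ suc)) (h ∘ suc))

anyFin-not : ∀ k {f g : Vector Bool k} → (∀ i → f i ≡ not (g i)) → anyFin k f ≡ not (allFin k g)
anyFin-not zero _ = refl
anyFin-not (suc k) {f} {g} h rewrite h zero with g zero
... | true = anyFin-not k (h ∘ suc)
... | false = refl

allFin-not : ∀ k {f g : Vector Bool k} → (∀ i → f i ≡ not (g i)) → allFin k f ≡ not (anyFin k g)
allFin-not zero _ = refl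
allFin-not (suc k) {f} {g} h rewrite h zero with g zero
... | true = refl
... | false = allFin-not k (h ∘ suc)

T-not-contrapose : ∀ {x y} → (T x → T y) → T (not y) → T (not x)
T-not-contrapose {false} _ _ = _
T-not-contrapose {true} {true} _ ()
T-not-contrapose {true} {false} f _ = f _

≥o-reflexive : ∀ {x y} → x ≡ y → x ≥o y
≥o-reflexive refl = refl≥

≥o-antisym : ∀ {x y} → x ≥o y → y ≥o x → x ≡ y
≥o-antisym refl≥ _ = refl
≥o-antisym top refl≥ = refl
≥o-antisym top top = refl
≥o-antisym bot refl≥ = refl
≥o-antisym bot bot = refl

≥o𝓟⇔ : ∀ {x} → x ≥o 𝓟 ⇔ (x ≡ 𝓛 ⊎ x ≡ 𝓟)
≥o𝓟⇔ = mk⇔ (λ { refl≥ → inj₂ refl ; top → inj₁ refl })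
            (λ { (inj₁ refl) → top ; (inj₂ refl) → refl≥ })

outcomeFrom-mono : ∀ {x y u v} → (T x → T u) → (T v → T y) → outcomeFrom u v ≥o outcomeFrom x y
outcomeFrom-mono {u = true} {v = false} _ _ = top
outcomeFrom-mono {x = false} {y = true} _ _ = bot
outcomeFrom-mono {x = true} {u = false} f _ = ⊥-elim (f _)
outcomeFrom-mono {y = false} {v = true} _ g = ⊥-elim (g _)
outcomeFrom-mono {true} {true} {true} {true} _ _ = refl≥
outcomeFrom-mono {false} {false} {false} {false} _ _ = refl≥

mutual
  rightFirst≡not-leftSecond : ∀ X → rightFirst X ≡ not (leftSecond X)
  rightFirst≡not-leftSecond ∞ = refl
  rightFirst≡not-leftSecond ∞̄ = refl
  rightFirst≡not-leftSecond (node m L n R) = anyFin-not (suc n) (λ j → rightSecond≡not-leftFirst (R j))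

  rightSecond≡not-leftFirst : ∀ X → rightSecond X ≡ not (leftFirst X)
  rightSecond≡not-leftFirst ∞ = refl
  rightSecond≡not-leftFirst ∞̄ = refl
  rightSecond≡not-leftFirst (node m L n R) = allFin-not (suc m) (λ i → rightFirst≡not-leftSecond (L i))

o-viaLeft : ∀ X → o X ≡ outcomeFrom (leftFirst X) (not (leftSecond X))
o-viaLeft X = cong (outcomeFrom (leftFirst X)) (rightFirst≡not-leftSecond X)

o-viaRight : ∀ X → o X ≡ outcomeFrom (not (rightSecond X)) (rightFirst X)
o-viaRight X = cong (λ x → outcomeFrom x (rightFirst X))
  (trans (sym (not-involutive (leftFirst X))) (cong not (sym (rightSecond≡not-leftFirst X))))

o-monoᴸ : ∀ A B → (T (leftFirst A) → T (leftFirst B)) → (T (leftSecond A) → T (leftSecond B)) →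
  o B ≥o o A
o-monoᴸ A B f s =
  subst₂ _≥o_ (sym (o-viaLeft B)) (sym (o-viaLeft A)) (outcomeFrom-mono f (T-not-contrapose s))

o-monoᴿ : ∀ A B → (T (rightFirst A) → T (rightFirst B)) → (T (rightSecond A) → T (rightSecond B)) →
  o A ≥o o B
o-monoᴿ A B f s =
  subst₂ _≥o_ (sym (o-viaRight A)) (sym (o-viaRight B)) (outcomeFrom-mono (T-not-contrapose s) f)

leftSecond-of-≥o𝓟 : ∀ X → o X ≥o 𝓟 → T (leftSecond X)
leftSecond-of-≥o𝓟 X p = helper (leftFirst X) (leftSecond X) (subst (_≥o 𝓟) (o-viaLeft X) p)
  where
  helper : ∀ x y → outcomeFrom x (not y) ≥o 𝓟 → T y
  helper _ true _ = _
  helper true false ()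
  helper false false ()

rightSecond-of-𝓟≥o : ∀ X → 𝓟 ≥o o X → T (rightSecond X)
rightSecond-of-𝓟≥o X p = helper (rightSecond X) (rightFirst X) (subst (𝓟 ≥o_) (o-viaRight X) p)
  where
  helper : ∀ x y → 𝓟 ≥o outcomeFrom (not x) y → T x
  helper true _ _ = _
  helper false true ()
  helper false false ()

⊕-options : Form → Vector Form a → Form → Vector Form b → Vector Form (a + b)
⊕-options A xs B ys = (λ i → xs i ⊕ B) ++ (λ j → A ⊕ ys j)

mutual
  leftSecond-⊕ : ∀ A B → T (leftSecond A) → T (leftSecond B) → T (leftSecond (A ⊕ B))
  leftSecond-⊕ ∞ _ _ _ = _
  leftSecond-⊕ (node _ _ _ _) ∞ _ _ = _
  leftSecond-⊕ A@(node m L n R) B@(node m′ L′ n′ R′) hA hB =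
    from (T-allFin leftFirst (⊕-options A R B R′)) (++⁺ (T ∘ leftFirst)
      (λ i → leftFirst-⊕ˡ (R i) B (to (T-allFin leftFirst R) hA i) hB)
      (λ j → leftFirst-⊕ʳ A (R′ j) hA (to (T-allFin leftFirst R′) hB j)))

  leftFirst-⊕ʳ : ∀ A B → T (leftSecond A) → T (leftFirst B) → T (leftFirst (A ⊕ B))
  leftFirst-⊕ʳ ∞ _ _ _ = _
  leftFirst-⊕ʳ (node _ _ _ _) ∞ _ _ = _
  leftFirst-⊕ʳ A@(node m L n R) B@(node m′ L′ n′ R′) hA hB =
    let (j , w) = to (T-anyFin leftSecond L′) hB in
    from (T-anyFin leftSecond (⊕-options A L B L′))
      (Any-++⁺ʳ (T ∘ leftSecond) (λ i → L i ⊕ B) (j , leftSecond-⊕ A (L′ j) hA w))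

  leftFirst-⊕ˡ : ∀ A B → T (leftFirst A) → T (leftSecond B) → T (leftFirst (A ⊕ B))
  leftFirst-⊕ˡ ∞ _ _ _ = _
  leftFirst-⊕ˡ (node _ _ _ _) ∞ _ _ = _
  leftFirst-⊕ˡ A@(node m L n R) B@(node m′ L′ n′ R′) hA hB =
    let (i , w) = to (T-anyFin leftSecond L) hA in
    from (T-anyFin leftSecond (⊕-options A L B L′))
      (Any-++⁺ˡ (T ∘ leftSecond) (λ j → A ⊕ L′ j) (i , leftSecond-⊕ (L i) B w hB))

mutual
  rightSecond-⊕ : ∀ A B → T (rightSecond A) → T (rightSecond B) → T (rightSecond (A ⊕ B))
  rightSecond-⊕ ∞̄ ∞̄ _ _ = _
  rightSecond-⊕ ∞̄ (node _ _ _ _) _ _ = _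
  rightSecond-⊕ (node _ _ _ _) ∞̄ _ _ = _
  rightSecond-⊕ A@(node m L n R) B@(node m′ L′ n′ R′) hA hB =
    from (T-allFin rightFirst (⊕-options A L B L′)) (++⁺ (T ∘ rightFirst)
      (λ i → rightFirst-⊕ˡ (L i) B (to (T-allFin rightFirst L) hA i) hB)
      (λ j → rightFirst-⊕ʳ A (L′ j) hA (to (T-allFin rightFirst L′) hB j)))

  rightFirst-⊕ʳ : ∀ A B → T (rightSecond A) → T (rightFirst B) → T (rightFirst (A ⊕ B))
  rightFirst-⊕ʳ ∞̄ ∞̄ _ _ = _
  rightFirst-⊕ʳ ∞̄ (node _ _ _ _) _ _ = _
  rightFirst-⊕ʳ (node _ _ _ _) ∞̄ _ _ = _
  rightFirst-⊕ʳ A@(node m L n R) B@(node m′ L′ n′ R′) hA hB =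
    let (j , w) = to (T-anyFin rightSecond R′) hB in
    from (T-anyFin rightSecond (⊕-options A R B R′))
      (Any-++⁺ʳ (T ∘ rightSecond) (λ i → R i ⊕ B) (j , rightSecond-⊕ A (R′ j) hA w))

  rightFirst-⊕ˡ : ∀ A B → T (rightFirst A) → T (rightSecond B) → T (rightFirst (A ⊕ B))
  rightFirst-⊕ˡ ∞̄ ∞̄ _ _ = _
  rightFirst-⊕ˡ ∞̄ (node _ _ _ _) _ _ = _
  rightFirst-⊕ˡ (node _ _ _ _) ∞̄ _ _ = _
  rightFirst-⊕ˡ A@(node m L n R) B@(node m′ L′ n′ R′) hA hB =
    let (i , w) = to (T-anyFin rightSecond R) hA in
    from (T-anyFin rightSecond (⊕-options A R B R′))
      (Any-++⁺ˡ (T ∘ rightSecond) (λ j → A ⊕ R′ j) (i , rightSecond-⊕ (R i) B w hB))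

leftSecond⇒⊕-≥o : ∀ D B → T (leftSecond D) → o (D ⊕ B) ≥o o B
leftSecond⇒⊕-≥o D B h = o-monoᴸ B (D ⊕ B) (leftFirst-⊕ʳ D B h) (leftSecond-⊕ D B h)

rightSecond⇒⊕-≤o : ∀ D B → T (rightSecond D) → o B ≥o o (D ⊕ B)
rightSecond⇒⊕-≤o D B h = o-monoᴿ B (D ⊕ B) (rightFirst-⊕ʳ D B h) (rightSecond-⊕ D B h)

o-zero⊕ : ∀ X → o (zeroF ⊕ X) ≡ o X
o-zero⊕ X = ≥o-antisym (leftSecond⇒⊕-≥o zeroF X _) (rightSecond⇒⊕-≤o zeroF X _)

record Matched (R : Form → Form → Set) (xs : Vector Form a) (ys : Vector Form b) : Set where
  constructor matched
  field
    forth : All (λ x → Any (R x) ys) xs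
    back : All (λ y → Any (flip R y) xs) ys

Matched-++ : ∀ {R} {xs : Vector Form a} {ys : Vector Form b}
  {xs′ : Vector Form c} {ys′ : Vector Form d} →
  Matched R xs xs′ → Matched R ys ys′ → Matched R (xs ++ ys) (xs′ ++ ys′)
Matched-++ {R = R} {xs} {ys} {xs′} {ys′} (matched f b) (matched f′ b′) = matched
  (++⁺ (λ x → Any (R x) (xs′ ++ ys′))
    (λ i → Any-++⁺ˡ (R (xs i)) ys′ (f i))
    (λ j → Any-++⁺ʳ (R (ys j)) xs′ (f′ j)))
  (++⁺ (λ y → Any (flip R y) (xs ++ ys))
    (λ i → Any-++⁺ˡ (flip R (xs′ i)) ys (b i))
    (λ j → Any-++⁺ʳ (flip R (ys′ j)) xs (b′ j)))

Matched-++-swap : ∀ {R} {xs : Vector Form a} {ys : Vector Form b}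
  {xs′ : Vector Form b} {ys′ : Vector Form a} →
  (∀ i → R (xs i) (ys′ i)) → (∀ j → R (ys j) (xs′ j)) → Matched R (xs ++ ys) (xs′ ++ ys′)
Matched-++-swap {R = R} {xs} {ys} {xs′} {ys′} p q = matched
  (++⁺ (λ x → Any (R x) (xs′ ++ ys′))
    (λ i → Any-++⁺ʳ (R (xs i)) xs′ (i , p i))
    (λ j → Any-++⁺ˡ (R (ys j)) ys′ (j , q j)))
  (++⁺ (λ y → Any (flip R y) (xs ++ ys))
    (λ j → Any-++⁺ʳ (flip R (xs′ j)) xs (j , q j))
    (λ i → Any-++⁺ˡ (flip R (ys′ i)) ys (i , p i)))

Matched-reassoc : ∀ {R} (f g : Form → Form)
  {xs : Vector Form a} {ys : Vector Form b} {zs : Vector Form c}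
  {xs′ : Vector Form a} {ys′ : Vector Form b} {zs′ : Vector Form c} →
  (∀ i → R (f (xs i)) (xs′ i)) → (∀ j → R (f (ys j)) (g (ys′ j))) →
  (∀ k → R (zs k) (g (zs′ k))) →
  Matched R (map f (xs ++ ys) ++ zs) (xs′ ++ map g (ys′ ++ zs′))
Matched-reassoc {R = R} f g {xs} {ys} {zs} {xs′} {ys′} {zs′} p q r = matched
  (++⁺ (λ x → Any (R x) rhs)
    (++⁺ (λ x → Any (R (f x)) rhs)
      (λ i → Any-++⁺ˡ (R (f (xs i))) _ (i , p i))
      (λ j → Any-++⁺ʳ (R (f (ys j))) xs′ (Any-++⁺ˡ (R (f (ys j)) ∘ g) zs′ (j , q j))))
    (λ k → Any-++⁺ʳ (R (zs k)) xs′ (Any-++⁺ʳ (R (zs k) ∘ g) ys′ (k , r k))))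
  (++⁺ (λ y → Any (flip R y) lhs)
    (λ i → Any-++⁺ˡ (flip R (xs′ i)) zs (Any-++⁺ˡ (flip R (xs′ i) ∘ f) ys (i , p i)))
    (++⁺ (λ y → Any (flip R (g y)) lhs)
      (λ j → Any-++⁺ˡ (flip R (g (ys′ j))) zs (Any-++⁺ʳ (flip R (g (ys′ j)) ∘ f) xs (j , q j)))
      (λ k → Any-++⁺ʳ (flip R (g (zs′ k))) (map f (xs ++ ys)) (k , r k))))
  where
  lhs = map f (xs ++ ys) ++ zs
  rhs = xs′ ++ map g (ys′ ++ zs′)

infix 4 _∼_

-- Bisimilarity: the options on each side can be matched up, allowing reordering and duplication.
data _∼_ : Form → Form → Set where
  ∞∼ : ∞ ∼ ∞
  ∞̄∼ : ∞̄ ∼ ∞̄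
  node∼ : ∀ {m L n R m′ L′ n′ R′} → Matched _∼_ L L′ → Matched _∼_ R R′ →
          node m L n R ∼ node m′ L′ n′ R′

∼-refl : A ∼ A
∼-refl {∞} = ∞∼
∼-refl {∞̄} = ∞̄∼
∼-refl {node m L n R} = node∼ (diagonal L) (diagonal R)
  where
  diagonal : (xs : Vector Form a) → Matched _∼_ xs xs
  diagonal xs = matched (λ i → i , ∼-refl) (λ i → i , ∼-refl)

∼-sym : A ∼ B → B ∼ A
∼-sym ∞∼ = ∞∼
∼-sym ∞̄∼ = ∞̄∼
∼-sym (node∼ l r) = node∼ (swap l) (swap r)
  where
  swap : {xs : Vector Form a} {ys : Vector Form b} → Matched _∼_ xs ys → Matched _∼_ ys xs
  swap (matched f b) = matched
    (λ j → let (i , p) = b j in i , ∼-sym p)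
    (λ i → let (j , p) = f i in j , ∼-sym p)

∼-trans : A ∼ B → B ∼ C → A ∼ C
∼-trans ∞∼ q = q
∼-trans ∞̄∼ q = q
∼-trans (node∼ l r) (node∼ l′ r′) = node∼ (compose l l′) (compose r r′)
  where
  compose : {xs : Vector Form a} {ys : Vector Form b} {zs : Vector Form c} →
    Matched _∼_ xs ys → Matched _∼_ ys zs → Matched _∼_ xs zs
  compose (matched f b) (matched f′ b′) = matched
    (λ i → let (j , p) = f i ; (k , q) = f′ j in k , ∼-trans p q)
    (λ k → let (j , q) = b′ k ; (i , p) = b j in i , ∼-trans p q)

∼-setoid : Setoid 0ℓ 0ℓ
∼-setoid = record
  { Carrier = Form
  ; _≈_ = _∼_
  ; isEquivalence = record { refl = ∼-refl ; sym = ∼-sym ; trans = ∼-trans }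
  }

⊕-cong : A ∼ A′ → B ∼ B′ → A ⊕ B ∼ A′ ⊕ B′
⊕-cong ∞∼ _ = ∞∼
⊕-cong ∞̄∼ ∞∼ = ∞∼
⊕-cong ∞̄∼ ∞̄∼ = ∞̄∼
⊕-cong ∞̄∼ (node∼ _ _) = ∞̄∼
⊕-cong (node∼ _ _) ∞∼ = ∞∼
⊕-cong (node∼ _ _) ∞̄∼ = ∞̄∼
⊕-cong p@(node∼ pL pR) q@(node∼ qL qR) =
  node∼ (Matched-++ (onLeft q pL) (onRight p qL)) (Matched-++ (onLeft q pR) (onRight p qR))
  where
  onLeft : {xs : Vector Form a} {xs′ : Vector Form b} → B ∼ B′ →
    Matched _∼_ xs xs′ → Matched _∼_ (λ i → xs i ⊕ B) (λ i → xs′ i ⊕ B′)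
  onLeft q (matched f b) = matched
    (λ i → let (j , r) = f i in j , ⊕-cong r q)
    (λ j → let (i , r) = b j in i , ⊕-cong r q)
  onRight : {ys : Vector Form a} {ys′ : Vector Form b} → A ∼ A′ →
    Matched _∼_ ys ys′ → Matched _∼_ (λ i → A ⊕ ys i) (λ i → A′ ⊕ ys′ i)
  onRight p (matched f b) = matched
    (λ i → let (j , r) = f i in j , ⊕-cong p r)
    (λ j → let (i , r) = b j in i , ⊕-cong p r)

⊕-comm : ∀ A B → A ⊕ B ∼ B ⊕ A
⊕-comm ∞ ∞ = ∞∼
⊕-comm ∞ ∞̄ = ∞∼
⊕-comm ∞ (node _ _ _ _) = ∞∼
⊕-comm ∞̄ ∞ = ∞∼
⊕-comm ∞̄ ∞̄ = ∞̄∼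
⊕-comm ∞̄ (node _ _ _ _) = ∞̄∼
⊕-comm (node _ _ _ _) ∞ = ∞∼
⊕-comm (node _ _ _ _) ∞̄ = ∞̄∼
⊕-comm A@(node _ L _ R) B@(node _ L′ _ R′) =
  node∼ (Matched-++-swap (λ i → ⊕-comm (L i) B) (λ j → ⊕-comm A (L′ j)))
        (Matched-++-swap (λ i → ⊕-comm (R i) B) (λ j → ⊕-comm A (R′ j)))

⊕-assoc : ∀ A B C → (A ⊕ B) ⊕ C ∼ A ⊕ (B ⊕ C)
⊕-assoc ∞ _ _ = ∞∼
⊕-assoc ∞̄ ∞ _ = ∞∼
⊕-assoc ∞̄ ∞̄ ∞ = ∞∼
⊕-assoc ∞̄ ∞̄ ∞̄ = ∞̄∼
⊕-assoc ∞̄ ∞̄ (node _ _ _ _) = ∞̄∼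
⊕-assoc ∞̄ (node _ _ _ _) ∞ = ∞∼
⊕-assoc ∞̄ (node _ _ _ _) ∞̄ = ∞̄∼
⊕-assoc ∞̄ (node _ _ _ _) (node _ _ _ _) = ∞̄∼
⊕-assoc (node _ _ _ _) ∞ _ = ∞∼
⊕-assoc (node _ _ _ _) ∞̄ ∞ = ∞∼
⊕-assoc (node _ _ _ _) ∞̄ ∞̄ = ∞̄∼
⊕-assoc (node _ _ _ _) ∞̄ (node _ _ _ _) = ∞̄∼
⊕-assoc (node _ _ _ _) (node _ _ _ _) ∞ = ∞∼
⊕-assoc (node _ _ _ _) (node _ _ _ _) ∞̄ = ∞̄∼
⊕-assoc A@(node _ LA _ RA) B@(node _ LB _ RB) C@(node _ LC _ RC) =
  node∼
    (Matched-reassoc (_⊕ C) (A ⊕_)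
      (λ i → ⊕-assoc (LA i) B C) (λ j → ⊕-assoc A (LB j) C) (λ k → ⊕-assoc A B (LC k)))
    (Matched-reassoc (_⊕ C) (A ⊕_)
      (λ i → ⊕-assoc (RA i) B C) (λ j → ⊕-assoc A (RB j) C) (λ k → ⊕-assoc A B (RC k)))

interchange : ∀ A B C D → (A ⊕ B) ⊕ (C ⊕ D) ∼ (C ⊕ B) ⊕ (A ⊕ D)
interchange A B C D = begin
  (A ⊕ B) ⊕ (C ⊕ D)  ≈⟨ ⊕-assoc A B (C ⊕ D) ⟩
  A ⊕ (B ⊕ (C ⊕ D))  ≈⟨ ⊕-cong ∼-refl (⊕-assoc B C D) ⟨
  A ⊕ ((B ⊕ C) ⊕ D)  ≈⟨ ⊕-cong ∼-refl (⊕-cong (⊕-comm B C) ∼-refl) ⟩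
  A ⊕ ((C ⊕ B) ⊕ D)  ≈⟨ ⊕-cong ∼-refl (⊕-comm (C ⊕ B) D) ⟩
  A ⊕ (D ⊕ (C ⊕ B))  ≈⟨ ⊕-assoc A D (C ⊕ B) ⟨
  (A ⊕ D) ⊕ (C ⊕ B)  ≈⟨ ⊕-comm (A ⊕ D) (C ⊕ B) ⟩
  (C ⊕ B) ⊕ (A ⊕ D)  ∎
  where open import Relation.Binary.Reasoning.Setoid ∼-setoid

mutual
  leftFirst-∼ : A ∼ B → T (leftFirst A) → T (leftFirst B)
  leftFirst-∼ ∞∼ t = t
  leftFirst-∼ ∞̄∼ t = t
  leftFirst-∼ (node∼ {L = L} {L′ = L′} (matched forth _) _) t =
    let (i , w) = to (T-anyFin leftSecond L) t ; (j , p) = forth i in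
    from (T-anyFin leftSecond L′) (j , leftSecond-∼ p w)

  leftSecond-∼ : A ∼ B → T (leftSecond A) → T (leftSecond B)
  leftSecond-∼ ∞∼ t = t
  leftSecond-∼ ∞̄∼ t = t
  leftSecond-∼ (node∼ {R = R} {R′ = R′} _ (matched _ back)) t =
    from (T-allFin leftFirst R′) λ j →
      let (i , p) = back j in leftFirst-∼ p (to (T-allFin leftFirst R) t i)

o-∼ : A ∼ B → o A ≡ o B
o-∼ {A} {B} p = ≥o-antisym (o-monoᴸ B A (leftFirst-∼ (∼-sym p)) (leftSecond-∼ (∼-sym p)))
                           (o-monoᴸ A B (leftFirst-∼ p) (leftSecond-∼ p))

⊕-nonAtomic : NonAtomic A → NonAtomic B → NonAtomic (A ⊕ B)
⊕-nonAtomic (node _ _ _ _) (node _ _ _ _) = node _ _ _ _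

∞̄⊕-nonAtomic : NonAtomic A → ∞̄ ⊕ A ≡ ∞̄
∞̄⊕-nonAtomic (node _ _ _ _) = refl

o≡𝓟⇒nonAtomicʳ : ∀ A B → Defined A B → o (A ⊕ B) ≡ 𝓟 → NonAtomic B
o≡𝓟⇒nonAtomicʳ _ (node _ _ _ _) _ _ = node _ _ _ _
o≡𝓟⇒nonAtomicʳ ∞ ∞ _ ()
o≡𝓟⇒nonAtomicʳ ∞̄ ∞ _ ()
o≡𝓟⇒nonAtomicʳ (node _ _ _ _) ∞ _ ()
o≡𝓟⇒nonAtomicʳ ∞ ∞̄ (undefined , _) _ = ⊥-elim (undefined (refl , refl))
o≡𝓟⇒nonAtomicʳ ∞̄ ∞̄ _ ()
o≡𝓟⇒nonAtomicʳ (node _ _ _ _) ∞̄ _ ()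

module Inverse {H N : Form} (inverse : IsInverse H N) where
  open ≡-Reasoning

  o-H⊕N⊕ : ∀ {X} → NonAtomic X → o ((H ⊕ N) ⊕ X) ≡ o X
  o-H⊕N⊕ {X} nX =
    let (H⊕N≽0 , 0≽H⊕N) = proj₂ inverse in
    trans (≥o-antisym (H⊕N≽0 X nX) (0≽H⊕N X nX)) (o-zero⊕ X)

  o-H⊕N : o (H ⊕ N) ≡ 𝓟
  o-H⊕N = begin
    o (H ⊕ N)            ≡⟨ o-zero⊕ (H ⊕ N) ⟨
    o (zeroF ⊕ (H ⊕ N))  ≡⟨ o-∼ (⊕-comm zeroF (H ⊕ N)) ⟩
    o ((H ⊕ N) ⊕ zeroF)  ≡⟨ o-H⊕N⊕ (node _ _ _ _) ⟩
    o zeroF              ∎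

  N-nonAtomic : NonAtomic N
  N-nonAtomic = o≡𝓟⇒nonAtomicʳ H N (proj₁ inverse) o-H⊕N

  o-cancel : ∀ {G X} → NonAtomic G → NonAtomic X → o ((G ⊕ N) ⊕ (H ⊕ X)) ≡ o (G ⊕ X)
  o-cancel {G} {X} nG nX = begin
    o ((G ⊕ N) ⊕ (H ⊕ X))  ≡⟨ o-∼ (interchange G N H X) ⟩
    o ((H ⊕ N) ⊕ (G ⊕ X))  ≡⟨ o-H⊕N⊕ (⊕-nonAtomic nG nX) ⟩
    o (G ⊕ X)              ∎

  ≽⇒≥o𝓟 : ∀ G → G ≽ H → o (G ⊕ N) ≥o 𝓟
  ≽⇒≥o𝓟 G G≽H = subst (o (G ⊕ N) ≥o_) o-H⊕N (G≽H N N-nonAtomic)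

  ≼⇒𝓟≥o : ∀ G → H ≽ G → 𝓟 ≥o o (G ⊕ N)
  ≼⇒𝓟≥o G H≽G = subst (_≥o o (G ⊕ N)) o-H⊕N (H≽G N N-nonAtomic)

  ≥o𝓟⇒≽ : ∀ G → o (G ⊕ N) ≥o 𝓟 → G ≽ H
  ≥o𝓟⇒≽ ∞ _ _ _ = top
  ≥o𝓟⇒≽ ∞̄ p =
    ⊥-elim (subst (T ∘ leftSecond) (∞̄⊕-nonAtomic N-nonAtomic)
      (leftSecond-of-≥o𝓟 (∞̄ ⊕ N) p))
  ≥o𝓟⇒≽ G@(node _ _ _ _) p X nX =
    subst (_≥o o (H ⊕ X)) (o-cancel (node _ _ _ _) nX)
      (leftSecond⇒⊕-≥o (G ⊕ N) (H ⊕ X) (leftSecond-of-≥o𝓟 (G ⊕ N) p))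

  𝓟≥o⇒≼ : ∀ G → 𝓟 ≥o o (G ⊕ N) → H ≽ G
  𝓟≥o⇒≼ ∞ p = ⊥-elim (rightSecond-of-𝓟≥o ∞ p)
  𝓟≥o⇒≼ ∞̄ _ X (node _ _ _ _) = bot
  𝓟≥o⇒≼ G@(node _ _ _ _) p X nX =
    subst (o (H ⊕ X) ≥o_) (o-cancel (node _ _ _ _) nX)
      (rightSecond⇒⊕-≤o (G ⊕ N) (H ⊕ X) (rightSecond-of-𝓟≥o (G ⊕ N) p))

theorem2p13 : (G H negH : Form) → IsInverse H negH →
    (G ≽ H ⇔ (o (G ⊕ negH) ≡ 𝓛 ⊎ o (G ⊕ negH) ≡ 𝓟))
    × (G ≈ H ⇔ o (G ⊕ negH) ≡ 𝓟)
theorem2p13 G H negH inverse =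
  mk⇔ (to ≥o𝓟⇔ ∘ ≽⇒≥o𝓟 G) (≥o𝓟⇒≽ G ∘ from ≥o𝓟⇔) ,
  mk⇔ (λ (G≽H , H≽G) → ≥o-antisym (≽⇒≥o𝓟 G G≽H) (≼⇒𝓟≥o G H≽G))
      (λ e → ≥o𝓟⇒≽ G (≥o-reflexive e) , 𝓟≥o⇒≼ G (≥o-reflexive (sym e)))
  where open Inverse inverse
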